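{- Let $T\in\partial\mathfrak{T}_3(n)$ and let $a,b$ be two distinct leaves of $T$. Then $a$ and $b$ are separated if and only if $N(a)$ and $N(b)$ are neither equal nor adjacent.
   Context: $\partial\mathfrak{T}_3(n)$: finite rooted trees in which each non-leaf vertex (node) has exactly two unordered children and a color in $\{1,\dots,n\}$ (leaves uncolored), regarded as structures on their leaf sets: isomorphisms are induced by color-preserving rooted-tree isomorphisms, and the substructure on a leaf subset $U$ is the spanned tree (rooted at the lowest common ancestor of $U$, vertices with a single remaining child suppressed, colors kept). For a leaf $x$, $N(x)$ is its parent node. Leaves $a,b$ are separated if $T$ is the unique amalgamation, in $\partial\mathfrak{T}_3(n)$, of $T\setminus a$ and $T\setminus b$ over $T\setminus\{a,b\}$, where an amalgamation is a structure $Z$ with jointly surjective embeddings of $T\setminus a$ and $T\setminus b$ agreeing on $T\setminus\{a,b\}$, counted up to compatible isomorphism. -}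

module Defs where

open import Data.Nat using (ℕ; _≟_)
open import Data.Fin using (Fin)
open import Data.Bool using (Bool; true; false; not; if_then_else_)
open import Data.Maybe using (Maybe; just; nothing)
open import Data.List using (List; []; _∷_; _++_; [_]; map)
open import Data.List.Membership.Propositional using (_∈_)
open import Data.List.Membership.DecPropositional _≟_ using (_∈?_)
open import Data.Product using (Σ; ∃; _×_; _,_)
open import Data.Sum using (_⊎_)
open import Relation.Nullary using (¬_)
open import Relation.Nullary.Decidable using (⌊_⌋)
open import Relation.Binary.PropositionalEquality using (_≡_)

-- Binary rooted trees; internal nodes (binary) carry a colour in Fin n,
-- leaves carry a label (the name of the leaf, a natural number).
-- Children are stored in an order, but the order is quotiented out by _≈_.
data Tree (n : ℕ) : Set where
  leaf : ℕ → Tree n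
  node : Fin n → Tree n → Tree n → Tree n

-- A structure of ∂T₃(n): possibly empty tree (empty leaf set = nothing).
Str : ℕ → Set
Str n = Maybe (Tree n)

leaves : ∀ {n} → Tree n → List ℕ
leaves (leaf x) = x ∷ []
leaves (node c l r) = leaves l ++ leaves r

leavesS : ∀ {n} → Str n → List ℕ
leavesS nothing = []
leavesS (just t) = leaves t

rename : ∀ {n} → (ℕ → ℕ) → Tree n → Tree n
rename f (leaf x) = leaf (f x)
rename f (node c l r) = node c (rename f l) (rename f r)

renameS : ∀ {n} → (ℕ → ℕ) → Str n → Str n
renameS f nothing = nothing
renameS f (just t) = just (rename f t)

-- Spanned subtree on the leaves satisfying U: rooted at their lowest common
-- ancestor, vertices left with a single child suppressed, colours kept.
combine : ∀ {n} → Fin n → Str n → Str n → Str n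
combine c (just l) (just r) = just (node c l r)
combine c (just l) nothing  = just l
combine c nothing  r        = r

restrict : ∀ {n} → (ℕ → Bool) → Tree n → Str n
restrict U (leaf x) = if U x then just (leaf x) else nothing
restrict U (node c l r) = combine c (restrict U l) (restrict U r)

restrictS : ∀ {n} → (ℕ → Bool) → Str n → Str n
restrictS U nothing = nothing
restrictS U (just t) = restrict U t

del : ∀ {n} → ℕ → Tree n → Str n
del a = restrict (λ y → not ⌊ y ≟ a ⌋)

del2 : ∀ {n} → ℕ → ℕ → Tree n → Str n
del2 a b = restrict (λ y → not ⌊ y ∈? (a ∷ b ∷ []) ⌋)

-- Equality up to colour-preserving rooted-tree isomorphism fixing leaf labels
-- (children unordered).
data _≈_ {n : ℕ} : Tree n → Tree n → Set where
  leaf : ∀ x → leaf x ≈ leaf x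
  node : ∀ c {l r l' r'} → l ≈ l' → r ≈ r' → node c l r ≈ node c l' r'
  swap : ∀ c {l r l' r'} → l ≈ r' → r ≈ l' → node c l r ≈ node c l' r'

data _≈S_ {n : ℕ} : Str n → Str n → Set where
  nothing : nothing ≈S nothing
  just : ∀ {s t} → s ≈ t → just s ≈S just t

InjOn : (ℕ → ℕ) → List ℕ → Set
InjOn f xs = ∀ {x y} → x ∈ xs → y ∈ xs → f x ≡ f y → x ≡ y

Embedding : ∀ {n} → (ℕ → ℕ) → Str n → Str n → Set
Embedding f S Z =
  InjOn f (leavesS S) ×
  (restrictS (λ z → ⌊ z ∈? map f (leavesS S) ⌋) Z ≈S renameS f S)

Isomorphism : ∀ {n} → (ℕ → ℕ) → Str n → Str n → Set
Isomorphism h S Z = InjOn h (leavesS S) × (renameS h S ≈S Z)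

-- (Z , f , g) is an amalgamation of A and B over C (C ⊆ A, C ⊆ B by inclusion).
IsAmalgamation : ∀ {n} → (A B C Z : Str n) → (f g : ℕ → ℕ) → Set
IsAmalgamation A B C Z f g =
  Embedding f A Z × Embedding g B Z ×
  (∀ {x} → x ∈ leavesS C → f x ≡ g x) ×
  (∀ {z} → z ∈ leavesS Z →
     (∃ λ x → x ∈ leavesS A × f x ≡ z) ⊎ (∃ λ y → y ∈ leavesS B × g y ≡ z))

AmalgEquiv : ∀ {n} → (A B Z : Str n) → (f g : ℕ → ℕ) →
             (Z' : Str n) → (f' g' : ℕ → ℕ) → Set
AmalgEquiv A B Z f g Z' f' g' =
  Σ (ℕ → ℕ) λ h → Isomorphism h Z Z' ×
    (∀ {x} → x ∈ leavesS A → h (f x) ≡ f' x) ×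
    (∀ {y} → y ∈ leavesS B → h (g y) ≡ g' y)

id : ℕ → ℕ
id x = x

open import Data.List.Relation.Unary.Unique.Propositional using (Unique)

WellFormed : ∀ {n} → Str n → Set
WellFormed S = Unique (leavesS S)

-- a, b separated in T: T (with the inclusions) is the unique amalgamation of
-- T\a and T\b over T\{a,b}, up to compatible isomorphism.
Separated : ∀ {n} → Tree n → ℕ → ℕ → Set
Separated T a b =
  IsAmalgamation (del a T) (del b T) (del2 a b T) (just T) id id ×
  (∀ (Z : Str _) (f g : ℕ → ℕ) → WellFormed Z →
     IsAmalgamation (del a T) (del b T) (del2 a b T) Z f g →
     AmalgEquiv (del a T) (del b T) Z f g (just T) id id)

-- Node addresses: paths from the root (false = left child, true = right child).
data LeafAt {n : ℕ} : Tree n → List Bool → ℕ → Set where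
  here : ∀ {x} → LeafAt (leaf x) [] x
  goL  : ∀ {c l r p x} → LeafAt l p x → LeafAt (node c l r) (false ∷ p) x
  goR  : ∀ {c l r p x} → LeafAt r p x → LeafAt (node c l r) (true ∷ p) x

-- q is the address of N(x), the parent node of leaf x.
ParentAt : ∀ {n} → Tree n → ℕ → List Bool → Set
ParentAt T x q = ∃ λ d → LeafAt T (q ++ [ d ]) x

Adjacent : List Bool → List Bool → Set
Adjacent p q = (∃ λ d → q ≡ p ++ [ d ]) ⊎ (∃ λ d → p ≡ q ++ [ d ])

-- Separation fails in two ways.  If a and b are siblings, T∖a is T∖b with a renamed to b, so
-- (T∖a, id, a ↦ b) is a second amalgamation, with fewer leaves than T.  If N(a) and N(b) are
-- adjacent, rotating the edge between them (so that b rather than a hangs from the upper node)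
-- gives a tree that is not isomorphic to T but has the same deletions of a and of b.
--
-- In every other position a case analysis (a is a child of the root and b lies at depth ≥ 3 in
-- the other subtree; a and b lie in different subtrees, neither of which is a single leaf; or
-- both lie in one subtree, by induction) shows two facts: T∖a is not T∖b with a renamed to b,
-- and every tree with the same deletions of a and of b as T is isomorphic to T.  Given an
-- amalgamation (Z, f, g), the first fact gives f b ≠ g a, so f and g have a common left inverse
-- h on the leaves of Z; renaming Z along h yields a tree with the deletions of T, hence
-- isomorphic to T, and h is the required compatible isomorphism.

module Submission where

open import Defs
open import Data.Nat using (ℕ; _≟_; _+_; _<_; _≤_; z≤n; s≤s)
open import Data.Nat.Properties using (+-comm; +-mono-≤; +-mono-<-≤; +-mono-≤-<; <-irrefl)
open import Data.Fin using (Fin)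
open import Data.Bool using (Bool; true; false; not; if_then_else_)
open import Data.Maybe using (Maybe; just; nothing; fromMaybe; _<∣>_)
open import Data.List using (List; []; _∷_; _++_; [_]; map; length)
open import Data.List.Properties using (length-++; length-map; map-++; map-id; ++-identityʳ)
open import Data.List.Membership.Propositional using (_∈_)
open import Data.List.Membership.Propositional.Properties using (∈-++⁺ˡ; ∈-++⁺ʳ; ∈-++⁻; ∈-map⁺; ∈-map⁻)
open import Data.List.Membership.DecPropositional _≟_ using (_∈?_)
open import Data.List.Relation.Unary.Any using (here; there)
open import Data.List.Relation.Unary.Any.Properties using (singleton⁻)
import Data.List.Relation.Unary.All as All
import Data.List.Relation.Unary.All.Properties as All
open import Data.List.Relation.Unary.AllPairs using ([]; _∷_)
open import Data.List.Relation.Unary.Unique.Propositional using (Unique)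
import Data.List.Relation.Unary.Unique.Propositional.Properties as Unique
open import Data.Product using (∃; _×_; _,_; proj₁; proj₂)
open import Data.Sum using (_⊎_; inj₁; inj₂; [_,_]′)
open import Data.Unit using (⊤; tt)
open import Data.Empty using (⊥; ⊥-elim)
open import Relation.Nullary using (¬_; Dec; yes; no)
open import Relation.Nullary.Decidable using (⌊_⌋)
open import Relation.Binary.PropositionalEquality
  using (_≡_; _≢_; refl; sym; trans; cong; cong₂; subst; subst₂; ≢-sym; module ≡-Reasoning)
open import Relation.Binary.Bundles using (Setoid)
import Relation.Binary.Reasoning.Setoid as SetoidReasoning
open import Function.Base using (_∘_)
open import Function.Bundles using (_⇔_; mk⇔)

private variable
  n : ℕ
  a b w x y : ℕ

⌊⌋-reflects : ∀ {A : Set} (A? : Dec A) {β : Bool} →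
              (A → β ≡ true) → (β ≡ true → A) → ⌊ A? ⌋ ≡ β
⌊⌋-reflects (yes p) {true}  _ _ = refl
⌊⌋-reflects (yes p) {false} f _ = sym (f p)
⌊⌋-reflects (no ¬p) {true}  _ g = ⊥-elim (¬p (g refl))
⌊⌋-reflects (no ¬p) {false} _ _ = refl

⌊⌋-true : ∀ {A : Set} (A? : Dec A) → A → ⌊ A? ⌋ ≡ true
⌊⌋-true A? p = ⌊⌋-reflects A? (λ _ → refl) (λ _ → p)

infix 4 _≢ᵇ_

_≢ᵇ_ : ℕ → ℕ → Bool
y ≢ᵇ a = not ⌊ y ≟ a ⌋

≢ᵇ-refl : ∀ a → (a ≢ᵇ a) ≡ false
≢ᵇ-refl a = cong not (⌊⌋-true (a ≟ a) refl)

≢⇒≢ᵇ : y ≢ a → (y ≢ᵇ a) ≡ true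
≢⇒≢ᵇ {y} {a} y≢a = cong not (⌊⌋-reflects (y ≟ a) (⊥-elim ∘ y≢a) (λ ()))

≢ᵇ⇒≢ : (y ≢ᵇ a) ≡ true → y ≢ a
≢ᵇ⇒≢ {y} {a} e with y ≟ a
≢ᵇ⇒≢ () | yes _
... | no y≢a = y≢a

≢ᵇ-false⇒≡ : (y ≢ᵇ a) ≡ false → y ≡ a
≢ᵇ-false⇒≡ {y} {a} e with y ≟ a
... | yes y≡a = y≡a
≢ᵇ-false⇒≡ () | no _

Unique-++⁻ : ∀ (xs : List ℕ) {ys} → Unique (xs ++ ys) →
             Unique xs × Unique ys × (∀ {x} → x ∈ xs → x ∈ ys → ⊥)
Unique-++⁻ []       u          = [] , u , λ ()
Unique-++⁻ (x ∷ xs) (x∉ ∷ u) with Unique-++⁻ xs u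
... | uxs , uys , disj = All.++⁻ˡ xs x∉ ∷ uxs , uys , disj′
  where
  disj′ : ∀ {z} → z ∈ x ∷ xs → z ∈ _ → ⊥
  disj′ (here refl) z∈ys = All.lookup (All.++⁻ʳ xs x∉) z∈ys refl
  disj′ (there z∈xs) z∈ys = disj z∈xs z∈ys

infix 4 _∈T_

_∈T_ : ℕ → Tree n → Set
x ∈T t = x ∈ leaves t

nonempty : (t : Tree n) → ∃ λ x → x ∈T t
nonempty (leaf x) = x , here refl
nonempty (node c l r) with nonempty l
... | x , x∈l = x , ∈-++⁺ˡ x∈l

Disjoint : Tree n → Tree n → Set
Disjoint l r = ∀ {x} → x ∈T l → x ∈T r → ⊥

data Distinct {n : ℕ} : Tree n → Set where
  leaf : Distinct (leaf x)
  node : ∀ {c} {l r : Tree n} → Distinct l → Distinct r → Disjoint l r → Distinct (node c l r)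

Distinctˢ : Str n → Set
Distinctˢ nothing = ⊤
Distinctˢ (just t) = Distinct t

Distinct-swap : ∀ {c} {l r : Tree n} → Distinct (node c l r) → Distinct (node c r l)
Distinct-swap (node dl dr disj) = node dr dl λ x∈r x∈l → disj x∈l x∈r

Unique⇒Distinct : (t : Tree n) → Unique (leaves t) → Distinct t
Unique⇒Distinct (leaf x) _ = leaf
Unique⇒Distinct (node c l r) u with Unique-++⁻ (leaves l) u
... | ul , ur , disj = node (Unique⇒Distinct l ul) (Unique⇒Distinct r ur) disj

Distinct⇒Unique : (t : Tree n) → Distinct t → Unique (leaves t)
Distinct⇒Unique (leaf x) _ = All.[] ∷ []
Distinct⇒Unique (node c l r) (node dl dr disj) =
  Unique.++⁺ (Distinct⇒Unique l dl) (Distinct⇒Unique r dr) (λ (x∈l , x∈r) → disj x∈l x∈r)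

Distinctˢ⇒Unique : (s : Str n) → Distinctˢ s → Unique (leavesS s)
Distinctˢ⇒Unique nothing  _ = []
Distinctˢ⇒Unique (just t) d = Distinct⇒Unique t d

Distinct⇒≡leaf : (t : Tree n) → Distinct t → (∀ {x} → x ∈T t → x ≡ y) → t ≡ leaf y
Distinct⇒≡leaf (leaf x) _ all≡ = cong leaf (all≡ (here refl))
Distinct⇒≡leaf (node c l r) (node _ _ disj) all≡ with nonempty l | nonempty r
... | x , x∈l | z , z∈r = ⊥-elim (disj x∈l (subst (_∈T r) z≡x z∈r))
  where
  z≡x = trans (all≡ (∈-++⁺ʳ (leaves l) z∈r)) (sym (all≡ (∈-++⁺ˡ x∈l)))

leaves-combine : ∀ c (s t : Str n) → leavesS (combine c s t) ≡ leavesS s ++ leavesS t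
leaves-combine c (just l) (just r) = refl
leaves-combine c (just l) nothing  = sym (++-identityʳ (leaves l))
leaves-combine c nothing  r        = refl

Distinct-combine : ∀ c (s t : Str n) → Distinctˢ s → Distinctˢ t →
                   (∀ {x} → x ∈ leavesS s → x ∈ leavesS t → ⊥) → Distinctˢ (combine c s t)
Distinct-combine c (just l) (just r) dl dr disj = node dl dr disj
Distinct-combine c (just l) nothing  dl _  _    = dl
Distinct-combine c nothing  r        _  dr _    = dr

∈-restrict⁻ : ∀ U (t : Tree n) → x ∈ leavesS (restrict U t) → x ∈T t × U x ≡ true
∈-restrict⁻ U (leaf y) x∈ with U y in Uy
∈-restrict⁻ U (leaf y) (here refl) | true = here refl , Uy
∈-restrict⁻ U (node c l r) x∈ rewrite leaves-combine c (restrict U l) (restrict U r)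
  with ∈-++⁻ (leavesS (restrict U l)) x∈
... | inj₁ x∈l = let x∈l′ , Ux = ∈-restrict⁻ U l x∈l in ∈-++⁺ˡ x∈l′ , Ux
... | inj₂ x∈r = let x∈r′ , Ux = ∈-restrict⁻ U r x∈r in ∈-++⁺ʳ (leaves l) x∈r′ , Ux

∈-restrict⁺ : ∀ U (t : Tree n) → x ∈T t → U x ≡ true → x ∈ leavesS (restrict U t)
∈-restrict⁺ U (leaf y) (here refl) Ux rewrite Ux = here refl
∈-restrict⁺ U (node c l r) x∈ Ux rewrite leaves-combine c (restrict U l) (restrict U r)
  with ∈-++⁻ (leaves l) x∈
... | inj₁ x∈l = ∈-++⁺ˡ (∈-restrict⁺ U l x∈l Ux)
... | inj₂ x∈r = ∈-++⁺ʳ (leavesS (restrict U l)) (∈-restrict⁺ U r x∈r Ux)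

restrict-all : ∀ U (t : Tree n) → (∀ {x} → x ∈T t → U x ≡ true) → restrict U t ≡ just t
restrict-all U (leaf y) all rewrite all (here refl) = refl
restrict-all U (node c l r) all
  rewrite restrict-all U l (λ x∈ → all (∈-++⁺ˡ x∈))
        | restrict-all U r (λ x∈ → all (∈-++⁺ʳ (leaves l) x∈)) = refl

restrictS-all : ∀ U (s : Str n) → (∀ {x} → x ∈ leavesS s → U x ≡ true) → restrictS U s ≡ s
restrictS-all U nothing  _   = refl
restrictS-all U (just t) all = restrict-all U t all

restrict≡nothing : ∀ U (t : Tree n) → restrict U t ≡ nothing → x ∈T t → U x ≡ false
restrict≡nothing {x = x} U t e x∈ with U x in Ux
... | false = refl
... | true with restrict U t | ∈-restrict⁺ U t x∈ Ux
restrict≡nothing U t refl x∈ | true | nothing | ()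

restrict-cong : ∀ U V (t : Tree n) → (∀ {x} → x ∈T t → U x ≡ V x) → restrict U t ≡ restrict V t
restrict-cong U V (leaf y) U≗V rewrite U≗V (here refl) = refl
restrict-cong U V (node c l r) U≗V
  rewrite restrict-cong U V l (λ x∈ → U≗V (∈-++⁺ˡ x∈))
        | restrict-cong U V r (λ x∈ → U≗V (∈-++⁺ʳ (leaves l) x∈)) = refl

Distinct-restrict : ∀ U (t : Tree n) → Distinct t → Distinctˢ (restrict U t)
Distinct-restrict U (leaf x) _ with U x
... | true  = leaf
... | false = tt
Distinct-restrict U (node c l r) (node dl dr disj) =
  Distinct-combine c (restrict U l) (restrict U r) (Distinct-restrict U l dl) (Distinct-restrict U r dr)
    (λ x∈l x∈r → disj (proj₁ (∈-restrict⁻ U l x∈l)) (proj₁ (∈-restrict⁻ U r x∈r)))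

lengthˢ : Str n → ℕ
lengthˢ s = length (leavesS s)

lengthˢ-combine : ∀ c (s t : Str n) → lengthˢ (combine c s t) ≡ lengthˢ s + lengthˢ t
lengthˢ-combine c s t rewrite leaves-combine c s t = length-++ (leavesS s)

length-restrict-≤ : ∀ U (t : Tree n) → lengthˢ (restrict U t) ≤ length (leaves t)
length-restrict-≤ U (leaf x) with U x
... | true  = s≤s z≤n
... | false = z≤n
length-restrict-≤ U (node c l r)
  rewrite lengthˢ-combine c (restrict U l) (restrict U r) | length-++ (leaves l) {leaves r} =
  +-mono-≤ (length-restrict-≤ U l) (length-restrict-≤ U r)

length-restrict-< : ∀ U (t : Tree n) → x ∈T t → U x ≡ false →
                    lengthˢ (restrict U t) < length (leaves t)
length-restrict-< U (leaf y) (here refl) Ux rewrite Ux = s≤s z≤n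
length-restrict-< U (node c l r) x∈ Ux
  rewrite lengthˢ-combine c (restrict U l) (restrict U r) | length-++ (leaves l) {leaves r}
  with ∈-++⁻ (leaves l) x∈
... | inj₁ x∈l = +-mono-<-≤ (length-restrict-< U l x∈l Ux) (length-restrict-≤ U r)
... | inj₂ x∈r = +-mono-≤-< (length-restrict-≤ U l) (length-restrict-< U r x∈r Ux)

≈-refl : {t : Tree n} → t ≈ t
≈-refl {t = leaf x}     = leaf x
≈-refl {t = node c l r} = node c ≈-refl ≈-refl

≈-sym : {s t : Tree n} → s ≈ t → t ≈ s
≈-sym (leaf x)     = leaf x
≈-sym (node c p q) = node c (≈-sym p) (≈-sym q)
≈-sym (swap c p q) = swap c (≈-sym q) (≈-sym p)

≈-trans : {s t u : Tree n} → s ≈ t → t ≈ u → s ≈ u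
≈-trans (leaf x)     q              = q
≈-trans (node c p q) (node .c p′ q′) = node c (≈-trans p p′) (≈-trans q q′)
≈-trans (node c p q) (swap .c p′ q′) = swap c (≈-trans p p′) (≈-trans q q′)
≈-trans (swap c p q) (node .c p′ q′) = swap c (≈-trans p q′) (≈-trans q p′)
≈-trans (swap c p q) (swap .c p′ q′) = node c (≈-trans p q′) (≈-trans q p′)

≈-swap : ∀ c {l r : Tree n} → node c l r ≈ node c r l
≈-swap c = swap c ≈-refl ≈-refl

≈S-refl : {s : Str n} → s ≈S s
≈S-refl {s = nothing} = nothing
≈S-refl {s = just t}  = just ≈-refl

≈S-sym : {s t : Str n} → s ≈S t → t ≈S s
≈S-sym nothing  = nothing
≈S-sym (just p) = just (≈-sym p)

≈S-trans : {s t u : Str n} → s ≈S t → t ≈S u → s ≈S u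
≈S-trans nothing  nothing  = nothing
≈S-trans (just p) (just q) = just (≈-trans p q)

≡⇒≈S : {s t : Str n} → s ≡ t → s ≈S t
≡⇒≈S refl = ≈S-refl

≈S-setoid : ℕ → Setoid _ _
≈S-setoid n = record
  { Carrier = Str n
  ; _≈_ = _≈S_
  ; isEquivalence = record { refl = ≈S-refl ; sym = ≈S-sym ; trans = ≈S-trans }
  }

module ≈S-Reasoning {n : ℕ} = SetoidReasoning (≈S-setoid n)

just-≈⁻ : {s t : Tree n} → just s ≈S just t → s ≈ t
just-≈⁻ (just p) = p

≈-leaf⁻ : {t : Tree n} → t ≈ leaf x → t ≡ leaf x
≈-leaf⁻ (leaf x) = refl

leaf-≈⁻ : leaf {n} x ≈ leaf y → x ≡ y
leaf-≈⁻ (leaf _) = refl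

∈-≈ : {s t : Tree n} → s ≈ t → x ∈T s → x ∈T t
∈-≈ (leaf x) x∈ = x∈
∈-≈ (node c {l} {r} {l′} p q) x∈ with ∈-++⁻ (leaves l) x∈
... | inj₁ x∈l = ∈-++⁺ˡ (∈-≈ p x∈l)
... | inj₂ x∈r = ∈-++⁺ʳ (leaves l′) (∈-≈ q x∈r)
∈-≈ (swap c {l} {r} {l′} p q) x∈ with ∈-++⁻ (leaves l) x∈
... | inj₁ x∈l = ∈-++⁺ʳ (leaves l′) (∈-≈ p x∈l)
... | inj₂ x∈r = ∈-++⁺ˡ (∈-≈ q x∈r)

∈-≈S-just : {s : Str n} {t : Tree n} → s ≈S just t → x ∈ leavesS s → x ∈T t
∈-≈S-just (just p) = ∈-≈ p

∈-just-≈S : {s : Str n} {t : Tree n} → s ≈S just t → x ∈T t → x ∈ leavesS s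
∈-just-≈S (just p) = ∈-≈ (≈-sym p)

length-≈ : {s t : Tree n} → s ≈ t → length (leaves s) ≡ length (leaves t)
length-≈ (leaf x) = refl
length-≈ (node c {l} {r} {l′} {r′} p q)
  rewrite length-++ (leaves l) {leaves r} | length-++ (leaves l′) {leaves r′} =
  cong₂ _+_ (length-≈ p) (length-≈ q)
length-≈ (swap c {l} {r} {l′} {r′} p q)
  rewrite length-++ (leaves l) {leaves r} | length-++ (leaves l′) {leaves r′} | length-≈ p | length-≈ q =
  +-comm (length (leaves r′)) (length (leaves l′))

Distinct-≈ : {s t : Tree n} → s ≈ t → Distinct s → Distinct t
Distinct-≈ (leaf x) _ = leaf
Distinct-≈ (node c p q) (node dl dr disj) =
  node (Distinct-≈ p dl) (Distinct-≈ q dr)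
       λ x∈l x∈r → disj (∈-≈ (≈-sym p) x∈l) (∈-≈ (≈-sym q) x∈r)
Distinct-≈ (swap c p q) (node dl dr disj) =
  node (Distinct-≈ q dr) (Distinct-≈ p dl)
       λ x∈l x∈r → disj (∈-≈ (≈-sym p) x∈r) (∈-≈ (≈-sym q) x∈l)

combine-≈ : ∀ c {s s′ t t′ : Str n} → s ≈S s′ → t ≈S t′ → combine c s t ≈S combine c s′ t′
combine-≈ c (just p) (just q) = just (node c p q)
combine-≈ c (just p) nothing  = just p
combine-≈ c nothing  q        = q

combine-comm : ∀ c (s t : Str n) → combine c s t ≈S combine c t s
combine-comm c (just l) (just r) = just (≈-swap c)
combine-comm c (just l) nothing  = ≈S-refl
combine-comm c nothing  (just r) = ≈S-refl
combine-comm c nothing  nothing  = nothing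

restrict-≈ : ∀ U {s t : Tree n} → s ≈ t → restrict U s ≈S restrict U t
restrict-≈ U (leaf x)     = ≈S-refl
restrict-≈ U (node c p q) = combine-≈ c (restrict-≈ U p) (restrict-≈ U q)
restrict-≈ U (swap c {_} {_} {l′} {r′} p q) =
  ≈S-trans (combine-≈ c (restrict-≈ U p) (restrict-≈ U q)) (combine-comm c (restrict U r′) (restrict U l′))

rename-≈ : ∀ f {s t : Tree n} → s ≈ t → rename f s ≈ rename f t
rename-≈ f (leaf x)     = leaf (f x)
rename-≈ f (node c p q) = node c (rename-≈ f p) (rename-≈ f q)
rename-≈ f (swap c p q) = swap c (rename-≈ f p) (rename-≈ f q)

renameS-≈ : ∀ f {s t : Str n} → s ≈S t → renameS f s ≈S renameS f t
renameS-≈ f nothing  = nothing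
renameS-≈ f (just p) = just (rename-≈ f p)

leaves-rename : ∀ f (t : Tree n) → leaves (rename f t) ≡ map f (leaves t)
leaves-rename f (leaf x) = refl
leaves-rename f (node c l r) rewrite leaves-rename f l | leaves-rename f r =
  sym (map-++ f (leaves l) (leaves r))

length-rename : ∀ f (t : Tree n) → length (leaves (rename f t)) ≡ length (leaves t)
length-rename f t rewrite leaves-rename f t = length-map f (leaves t)

length-renameS-≈ : ∀ f (s : Str n) {t} → renameS f s ≈S just t → lengthˢ s ≡ length (leaves t)
length-renameS-≈ f (just s) (just p) = trans (sym (length-rename f s)) (length-≈ p)

∈-rename⁺ : ∀ f (t : Tree n) → x ∈T t → f x ∈T rename f t
∈-rename⁺ f t x∈ rewrite leaves-rename f t = ∈-map⁺ f x∈

∈-rename⁻ : ∀ f (t : Tree n) → y ∈T rename f t → ∃ λ x → x ∈T t × y ≡ f x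
∈-rename⁻ f t y∈ rewrite leaves-rename f t = ∈-map⁻ f y∈

rename-cong : ∀ f g (t : Tree n) → (∀ {x} → x ∈T t → f x ≡ g x) → rename f t ≡ rename g t
rename-cong f g (leaf x) f≗g = cong leaf (f≗g (here refl))
rename-cong f g (node c l r) f≗g =
  cong₂ (node c) (rename-cong f g l (λ x∈ → f≗g (∈-++⁺ˡ x∈)))
                 (rename-cong f g r (λ x∈ → f≗g (∈-++⁺ʳ (leaves l) x∈)))

renameS-cong : ∀ f g (s : Str n) → (∀ {x} → x ∈ leavesS s → f x ≡ g x) → renameS f s ≡ renameS g s
renameS-cong f g nothing  _   = refl
renameS-cong f g (just t) f≗g = cong just (rename-cong f g t f≗g)

rename-id : (t : Tree n) → rename id t ≡ t
rename-id (leaf x)     = refl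
rename-id (node c l r) = cong₂ (node c) (rename-id l) (rename-id r)

renameS-id : (s : Str n) → renameS id s ≡ s
renameS-id nothing  = refl
renameS-id (just t) = cong just (rename-id t)

renameS-id-on : ∀ f (s : Str n) → (∀ {x} → x ∈ leavesS s → f x ≡ x) → renameS f s ≡ s
renameS-id-on f s f≗id = trans (renameS-cong f id s f≗id) (renameS-id s)

renameS-∘ : ∀ f g (s : Str n) → renameS f (renameS g s) ≡ renameS (λ x → f (g x)) s
renameS-∘ f g nothing  = refl
renameS-∘ f g (just t) = cong just (rename-∘ t)
  where
  rename-∘ : (t : Tree n) → rename f (rename g t) ≡ rename (λ x → f (g x)) t
  rename-∘ (leaf x)     = refl
  rename-∘ (node c l r) = cong₂ (node c) (rename-∘ l) (rename-∘ r)

renameS-combine : ∀ f c (s t : Str n) → renameS f (combine c s t) ≡ combine c (renameS f s) (renameS f t)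
renameS-combine f c (just l) (just r) = refl
renameS-combine f c (just l) nothing  = refl
renameS-combine f c nothing  r        = refl

renameS-restrict : ∀ f U (t : Tree n) → renameS f (restrict (λ z → U (f z)) t) ≡ restrict U (rename f t)
renameS-restrict f U (leaf x) with U (f x)
... | true  = refl
... | false = refl
renameS-restrict f U (node c l r)
  rewrite renameS-combine f c (restrict (λ z → U (f z)) l) (restrict (λ z → U (f z)) r)
        | renameS-restrict f U l | renameS-restrict f U r = refl

Distinct-rename : ∀ f (t : Tree n) → Distinct t → InjOn f (leaves t) → Distinct (rename f t)
Distinct-rename f (leaf x) _ _ = leaf
Distinct-rename f (node c l r) (node dl dr disj) inj =
  node (Distinct-rename f l dl (λ x∈ y∈ → inj (∈-++⁺ˡ x∈) (∈-++⁺ˡ y∈)))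
       (Distinct-rename f r dr (λ x∈ y∈ → inj (∈-++⁺ʳ (leaves l) x∈) (∈-++⁺ʳ (leaves l) y∈)))
       disj′
  where
  disj′ : Disjoint (rename f l) (rename f r)
  disj′ z∈l z∈r with ∈-rename⁻ f l z∈l | ∈-rename⁻ f r z∈r
  ... | x , x∈l , refl | y , y∈r , fx≡fy =
    disj x∈l (subst (_∈T r) (sym (inj (∈-++⁺ˡ x∈l) (∈-++⁺ʳ (leaves l) y∈r) fx≡fy)) y∈r)

∈-del⁻ : ∀ a (t : Tree n) → x ∈ leavesS (del a t) → x ∈T t × x ≢ a
∈-del⁻ a t x∈ = let x∈t , x≢ᵇa = ∈-restrict⁻ (_≢ᵇ a) t x∈ in x∈t , ≢ᵇ⇒≢ x≢ᵇa

∈-del⁺ : ∀ a (t : Tree n) → x ∈T t → x ≢ a → x ∈ leavesS (del a t)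
∈-del⁺ a t x∈ x≢a = ∈-restrict⁺ (_≢ᵇ a) t x∈ (≢⇒≢ᵇ x≢a)

∈-del-just⁻ : ∀ a (t : Tree n) {s} → del a t ≡ just s → x ∈T s → x ∈T t × x ≢ a
∈-del-just⁻ a t e x∈ = ∈-del⁻ a t (subst (λ s → _ ∈ leavesS s) (sym e) x∈)

∈-del-just⁺ : ∀ a (t : Tree n) {s} → del a t ≡ just s → x ∈T t → x ≢ a → x ∈T s
∈-del-just⁺ a t e x∈ x≢a = subst (λ s → _ ∈ leavesS s) e (∈-del⁺ a t x∈ x≢a)

del-∉ : ∀ a (t : Tree n) → ¬ a ∈T t → del a t ≡ just t
del-∉ a t a∉ = restrict-all (_≢ᵇ a) t (λ x∈ → ≢⇒≢ᵇ (λ x≡a → a∉ (subst (_∈T t) x≡a x∈)))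

del≡nothing : ∀ a (t : Tree n) → Distinct t → del a t ≡ nothing → t ≡ leaf a
del≡nothing a t dt e = Distinct⇒≡leaf t dt (λ x∈ → ≢ᵇ-false⇒≡ (restrict≡nothing (_≢ᵇ a) t e x∈))

del-just : ∀ a (t : Tree n) → Distinct t → t ≢ leaf a → ∃ λ s → del a t ≡ just s
del-just a t dt t≢a with del a t in e
... | just s  = s , refl
... | nothing = ⊥-elim (t≢a (del≡nothing a t dt e))

∈⇒≢leaf : {t : Tree n} → y ∈T t → y ≢ x → t ≢ leaf x
∈⇒≢leaf y∈ y≢x refl = y≢x (singleton⁻ y∈)

del-leaf-self : ∀ a → del {n} a (leaf a) ≡ nothing
del-leaf-self a rewrite ≢ᵇ-refl a = refl

del-leaf : b ≢ a → del {n} a (leaf b) ≡ just (leaf b)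
del-leaf b≢a rewrite ≢⇒≢ᵇ b≢a = refl

del-≈ : ∀ a {s t : Tree n} → s ≈ t → del a s ≈S del a t
del-≈ a = restrict-≈ (_≢ᵇ a)

Distinct-del : ∀ a (t : Tree n) {s} → Distinct t → del a t ≡ just s → Distinct s
Distinct-del a t dt e = subst Distinctˢ e (Distinct-restrict (_≢ᵇ a) t dt)

∈-del2⁺ : ∀ a b (t : Tree n) → x ∈T t → x ≢ a → x ≢ b → x ∈ leavesS (del2 a b t)
∈-del2⁺ {x = x} a b t x∈ x≢a x≢b =
  ∈-restrict⁺ _ t x∈ (cong not (⌊⌋-reflects (x ∈? a ∷ b ∷ []) neither λ ()))
  where
  neither : x ∈ a ∷ b ∷ [] → false ≡ true
  neither (here x≡a)         = ⊥-elim (x≢a x≡a)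
  neither (there (here x≡b)) = ⊥-elim (x≢b x≡b)

∈-del2⁻ : ∀ a b (t : Tree n) → x ∈ leavesS (del2 a b t) → x ≢ a
∈-del2⁻ {x = x} a b t x∈ refl with ∈-restrict⁻ _ t x∈
... | _ , kept rewrite ⌊⌋-true (x ∈? x ∷ b ∷ []) (here refl) with kept
... | ()

Adjacent-cons : ∀ d {p q : List Bool} → Adjacent p q → Adjacent (d ∷ p) (d ∷ q)
Adjacent-cons d (inj₁ (e , q≡)) = inj₁ (e , cong (d ∷_) q≡)
Adjacent-cons d (inj₂ (e , p≡)) = inj₂ (e , cong (d ∷_) p≡)

Adjacent-sym : {p q : List Bool} → Adjacent p q → Adjacent q p
Adjacent-sym (inj₁ adj) = inj₂ adj
Adjacent-sym (inj₂ adj) = inj₁ adj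

LeafAt⇒∈ : {t : Tree n} {p : List Bool} → LeafAt t p x → x ∈T t
LeafAt⇒∈ here = here refl
LeafAt⇒∈ (goL at) = ∈-++⁺ˡ (LeafAt⇒∈ at)
LeafAt⇒∈ {t = node c l r} (goR at) = ∈-++⁺ʳ (leaves l) (LeafAt⇒∈ at)

¬LeafAt-leaf : ∀ p d → ¬ LeafAt (leaf {n} y) (p ++ [ d ]) x
¬LeafAt-leaf []      d ()
¬LeafAt-leaf (_ ∷ p) d ()

LeafAt⇒≢leaf : {t : Tree n} → ∀ p d → LeafAt t (p ++ [ d ]) x → t ≢ leaf y
LeafAt⇒≢leaf p d at refl = ¬LeafAt-leaf p d at

Third : Tree n → ℕ → ℕ → Set
Third t a b = ∃ λ z → z ∈T t × z ≢ a × z ≢ b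

other-leaf : {t : Tree n} {e : Bool} {q : List Bool} → Distinct t → LeafAt t (e ∷ q) x →
             ∃ λ w → w ∈T t × w ≢ x
other-leaf {t = node c l r} (node _ _ disj) (goL at) with nonempty r
... | w , w∈r = w , ∈-++⁺ʳ (leaves l) w∈r , λ { refl → disj (LeafAt⇒∈ at) w∈r }
other-leaf {t = node c l r} (node _ _ disj) (goR at) with nonempty l
... | w , w∈l = w , ∈-++⁺ˡ w∈l , λ { refl → disj w∈l (LeafAt⇒∈ at) }

other-leaf-below : {t : Tree n} → ∀ p d → Distinct t → LeafAt t (p ++ [ d ]) x →
                   ∃ λ w → w ∈T t × w ≢ x
other-leaf-below []      d = other-leaf
other-leaf-below (_ ∷ p) d = other-leaf

Third-sym : {t : Tree n} → Third t a b → Third t b a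
Third-sym (z , z∈ , z≢a , z≢b) = z , z∈ , z≢b , z≢a

third-leaf-root : {t : Tree n} → ∀ da e q db → Distinct t →
                  LeafAt t [ da ] a → LeafAt t (e ∷ (q ++ [ db ])) b → Third t a b
third-leaf-root false false q db _ (goL here) (goL at) = ⊥-elim (¬LeafAt-leaf q db at)
third-leaf-root {a = a} false true q db (node _ dr disj) (goL here) (goR at) with other-leaf-below q db dr at
... | w , w∈r , w≢b = w , ∈-++⁺ʳ [ a ] w∈r , (λ { refl → disj (here refl) w∈r }) , w≢b
third-leaf-root true true q db _ (goR here) (goR at) = ⊥-elim (¬LeafAt-leaf q db at)
third-leaf-root true false q db (node dl _ disj) (goR here) (goL at) with other-leaf-below q db dl at
... | w , w∈l , w≢b = w , ∈-++⁺ˡ w∈l , (λ { refl → disj w∈l (here refl) }) , w≢b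

third-leaf : (t : Tree n) → ∀ qa da qb db → Distinct t →
             LeafAt t (qa ++ [ da ]) a → LeafAt t (qb ++ [ db ]) b → qa ≢ qb → Third t a b
third-leaf t [] da [] db _ _ _ qa≢qb = ⊥-elim (qa≢qb refl)
third-leaf t [] da (e ∷ qb) db dt at-a at-b _ = third-leaf-root da e qb db dt at-a at-b
third-leaf t (e ∷ qa) da [] db dt at-a at-b _ = Third-sym {t = t} (third-leaf-root db e qa da dt at-b at-a)
third-leaf (node c l r) (false ∷ qa) da (false ∷ qb) db (node dl _ _) (goL at-a) (goL at-b) qa≢qb
  with third-leaf l qa da qb db dl at-a at-b (qa≢qb ∘ cong (false ∷_))
... | z , z∈l , z≢a , z≢b = z , ∈-++⁺ˡ z∈l , z≢a , z≢b
third-leaf (node c l r) (true ∷ qa) da (true ∷ qb) db (node _ dr _) (goR at-a) (goR at-b) qa≢qb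
  with third-leaf r qa da qb db dr at-a at-b (qa≢qb ∘ cong (true ∷_))
... | z , z∈r , z≢a , z≢b = z , ∈-++⁺ʳ (leaves l) z∈r , z≢a , z≢b
third-leaf (node c l r) (false ∷ qa) da (true ∷ qb) db (node dl _ disj) (goL at-a) (goR at-b) _
  with other-leaf-below qa da dl at-a
... | w , w∈l , w≢a = w , ∈-++⁺ˡ w∈l , w≢a , λ { refl → disj w∈l (LeafAt⇒∈ at-b) }
third-leaf (node c l r) (true ∷ qa) da (false ∷ qb) db (node _ dr disj) (goR at-a) (goL at-b) _
  with other-leaf-below qa da dr at-a
... | w , w∈r , w≢a = w , ∈-++⁺ʳ (leaves l) w∈r , w≢a , λ { refl → disj (LeafAt⇒∈ at-b) w∈r }

record NonSiblingInduction (P : Tree n → ℕ → ℕ → Set) : Set where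
  field
    mirror : ∀ a b c (l r : Tree n) → P (node c r l) a b → P (node c l r) a b
    flip : ∀ a b (t : Tree n) → P t b a → P t a b
    leaf-beside-deep : ∀ a b c d (X Y : Tree n) → a ≢ b → Distinct (node c (leaf a) (node d X Y)) →
      X ≢ leaf b → Y ≢ leaf b → P (node c (leaf a) (node d X Y)) a b
    apart : ∀ a b c (l r : Tree n) → a ≢ b → Distinct (node c l r) →
      a ∈T l → l ≢ leaf a → b ∈T r → r ≢ leaf b → P (node c l r) a b
    together : ∀ a b c (l r : Tree n) → a ≢ b → Distinct (node c l r) →
      a ∈T l → b ∈T l → Third l a b → P l a b → P (node c l r) a b

module _ {P : Tree n → ℕ → ℕ → Set} (ind : NonSiblingInduction P) where
  open NonSiblingInduction ind

  private
    beside-deep : ∀ a b c (r : Tree n) {e q db} → a ≢ b → Distinct (node c (leaf a) r) →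
                  LeafAt r (e ∷ (q ++ [ db ])) b → P (node c (leaf a) r) a b
    beside-deep a b c (node d X Y) {q = q} {db} a≢b dt@(node _ (node _ _ disj) _) (goL at) =
      leaf-beside-deep a b c d X Y a≢b dt (LeafAt⇒≢leaf q db at) (λ { refl → disj (LeafAt⇒∈ at) (here refl) })
    beside-deep a b c (node d X Y) {q = q} {db} a≢b dt@(node _ (node _ _ disj) _) (goR at) =
      leaf-beside-deep a b c d X Y a≢b dt (λ { refl → disj (here refl) (LeafAt⇒∈ at) }) (LeafAt⇒≢leaf q db at)

    leaf-beside : (t : Tree n) → ∀ a b → a ≢ b → Distinct t → ∀ da e q db →
                  LeafAt t [ da ] a → LeafAt t (e ∷ (q ++ [ db ])) b → ¬ Adjacent [] (e ∷ q) → P t a b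
    leaf-beside _ _ _ _ _ false false q db (goL here) (goL at) _ = ⊥-elim (¬LeafAt-leaf q db at)
    leaf-beside _ _ _ _ _ false true [] db (goL here) (goR at) nadj = ⊥-elim (nadj (inj₁ (true , refl)))
    leaf-beside (node c _ r) a b a≢b dt false true (_ ∷ q) db (goL here) (goR at) _ = beside-deep a b c r a≢b dt at
    leaf-beside _ _ _ _ _ true true q db (goR here) (goR at) _ = ⊥-elim (¬LeafAt-leaf q db at)
    leaf-beside _ _ _ _ _ true false [] db (goR here) (goL at) nadj = ⊥-elim (nadj (inj₁ (false , refl)))
    leaf-beside (node c l _) a b a≢b dt true false (_ ∷ q) db (goR here) (goL at) _ =
      mirror a b c l (leaf a) (beside-deep a b c l a≢b (Distinct-swap dt) at)

  non-sibling-induction : (t : Tree n) → ∀ a b → a ≢ b → Distinct t → ∀ qa da qb db →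
    LeafAt t (qa ++ [ da ]) a → LeafAt t (qb ++ [ db ]) b → qa ≢ qb → ¬ Adjacent qa qb → P t a b
  non-sibling-induction (leaf x) _ _ _ _ qa da _ _ at-a _ _ _ = ⊥-elim (¬LeafAt-leaf qa da at-a)
  non-sibling-induction (node c l r) _ _ _ _ [] _ [] _ _ _ qa≢qb _ = ⊥-elim (qa≢qb refl)
  non-sibling-induction t a b a≢b dt [] da (e ∷ qb) db at-a at-b _ nadj =
    leaf-beside t a b a≢b dt da e qb db at-a at-b nadj
  non-sibling-induction t a b a≢b dt (e ∷ qa) da [] db at-a at-b _ nadj =
    flip a b t (leaf-beside t b a (≢-sym a≢b) dt db e qa da at-b at-a (nadj ∘ Adjacent-sym))
  non-sibling-induction (node c l r) a b a≢b dt@(node dl _ _) (false ∷ qa) da (false ∷ qb) db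
                        (goL at-a) (goL at-b) qa≢qb nadj =
    together a b c l r a≢b dt (LeafAt⇒∈ at-a) (LeafAt⇒∈ at-b) (third-leaf l qa da qb db dl at-a at-b qa≢qb′)
      (non-sibling-induction l a b a≢b dl qa da qb db at-a at-b qa≢qb′ (nadj ∘ Adjacent-cons false))
    where
    qa≢qb′ = qa≢qb ∘ cong (false ∷_)
  non-sibling-induction (node c l r) a b a≢b dt@(node _ dr _) (true ∷ qa) da (true ∷ qb) db
                        (goR at-a) (goR at-b) qa≢qb nadj =
    mirror a b c l r (together a b c r l a≢b (Distinct-swap dt) (LeafAt⇒∈ at-a) (LeafAt⇒∈ at-b)
      (third-leaf r qa da qb db dr at-a at-b qa≢qb′)
      (non-sibling-induction r a b a≢b dr qa da qb db at-a at-b qa≢qb′ (nadj ∘ Adjacent-cons true)))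
    where
    qa≢qb′ = qa≢qb ∘ cong (true ∷_)
  non-sibling-induction (node c l r) a b a≢b dt (false ∷ qa) da (true ∷ qb) db (goL at-a) (goR at-b) _ _ =
    apart a b c l r a≢b dt (LeafAt⇒∈ at-a) (LeafAt⇒≢leaf qa da at-a)
      (LeafAt⇒∈ at-b) (LeafAt⇒≢leaf qb db at-b)
  non-sibling-induction (node c l r) a b a≢b dt (true ∷ qa) da (false ∷ qb) db (goR at-a) (goL at-b) _ _ =
    mirror a b c l r (apart a b c r l a≢b (Distinct-swap dt) (LeafAt⇒∈ at-a) (LeafAt⇒≢leaf qa da at-a)
      (LeafAt⇒∈ at-b) (LeafAt⇒≢leaf qb db at-b))

relabel : ℕ → ℕ → ℕ → ℕ
relabel a b z = if ⌊ z ≟ a ⌋ then b else z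

relabel-self : ∀ a b → relabel a b a ≡ b
relabel-self a b rewrite ⌊⌋-true (a ≟ a) refl = refl

relabel-≢ : ∀ {z} → z ≢ a → relabel a b z ≡ z
relabel-≢ {a} {b} {z} z≢a with z ≟ a
... | yes z≡a = ⊥-elim (z≢a z≡a)
... | no _    = refl

rename-relabel-∉ : ∀ a b (t : Tree n) → ¬ a ∈T t → rename (relabel a b) t ≡ t
rename-relabel-∉ a b t a∉ =
  trans (rename-cong (relabel a b) id t (λ z∈ → relabel-≢ (λ { refl → a∉ z∈ }))) (rename-id t)

Interchangeable : Tree n → ℕ → ℕ → Set
Interchangeable t a b = del a t ≈S renameS (relabel a b) (del b t)

Interchangeable-sym : ∀ a b (t : Tree n) → Interchangeable t a b → Interchangeable t b a
Interchangeable-sym a b t int = ≈S-sym (≈S-trans (renameS-≈ (relabel b a) int) (≡⇒≈S round-trip))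
  where
  round-trip : renameS (relabel b a) (renameS (relabel a b) (del b t)) ≡ del b t
  round-trip = trans (renameS-∘ (relabel b a) (relabel a b) (del b t))
                     (renameS-id-on _ (del b t) λ z∈ → back (proj₂ (∈-del⁻ b t z∈)))
    where
    back : ∀ {z} → z ≢ b → relabel b a (relabel a b z) ≡ z
    back {z} z≢b with z ≟ a
    ... | yes refl = relabel-self b a
    ... | no z≢a   = relabel-≢ z≢b

Interchangeable-≈ : ∀ a b {s t : Tree n} → s ≈ t → Interchangeable t a b → Interchangeable s a b
Interchangeable-≈ a b s≈t int =
  ≈S-trans (del-≈ a s≈t) (≈S-trans int (renameS-≈ (relabel a b) (del-≈ b (≈-sym s≈t))))

Interchangeable-cherry : ∀ {n} (c : Fin n) → a ≢ b → Interchangeable (node c (leaf a) (leaf b)) a b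
Interchangeable-cherry {a = a} {b = b} {n = n} c a≢b
  rewrite del-leaf-self {n = n} a | del-leaf {n = n} (≢-sym a≢b) | del-leaf-self {n = n} b | del-leaf {n = n} a≢b
        | relabel-self a b = ≈S-refl

Interchangeable-node : ∀ c (l r : Tree n) → ¬ a ∈T r → ¬ b ∈T r →
                       Interchangeable l a b → Interchangeable (node c l r) a b
Interchangeable-node {a = a} {b} c l r a∉r b∉r int = begin
  combine c (del a l) (del a r)
    ≡⟨ cong (combine c (del a l)) (del-∉ a r a∉r) ⟩
  combine c (del a l) (just r)
    ≈⟨ combine-≈ c int ≈S-refl ⟩
  combine c (renameS σ (del b l)) (just r)
    ≡⟨ cong (combine c _) (cong just (rename-relabel-∉ a b r a∉r)) ⟨
  combine c (renameS σ (del b l)) (renameS σ (just r))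
    ≡⟨ renameS-combine σ c (del b l) (just r) ⟨
  renameS σ (combine c (del b l) (just r))
    ≡⟨ cong (renameS σ ∘ combine c (del b l)) (del-∉ b r b∉r) ⟨
  renameS σ (combine c (del b l) (del b r))
    ∎
  where
  open ≈S-Reasoning
  σ = relabel a b

siblings⇒Interchangeable : ∀ (t : Tree n) q da db → a ≢ b → Distinct t →
  LeafAt t (q ++ [ da ]) a → LeafAt t (q ++ [ db ]) b → Interchangeable t a b
siblings⇒Interchangeable _ [] false false a≢b _ (goL here) (goL here) = ⊥-elim (a≢b refl)
siblings⇒Interchangeable _ [] true true a≢b _ (goR here) (goR here) = ⊥-elim (a≢b refl)
siblings⇒Interchangeable (node c _ _) [] false true a≢b _ (goL here) (goR here) = Interchangeable-cherry c a≢b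
siblings⇒Interchangeable {a = a} {b} (node c _ _) [] true false a≢b _ (goR here) (goL here) =
  Interchangeable-≈ a b (≈-swap c {leaf b} {leaf a}) (Interchangeable-cherry c a≢b)
siblings⇒Interchangeable (node c l r) (false ∷ q) da db a≢b (node dl _ disj) (goL at-a) (goL at-b) =
  Interchangeable-node c l r (disj (LeafAt⇒∈ at-a)) (disj (LeafAt⇒∈ at-b))
    (siblings⇒Interchangeable l q da db a≢b dl at-a at-b)
siblings⇒Interchangeable {a = a} {b} (node c l r) (true ∷ q) da db a≢b (node _ dr disj) (goR at-a) (goR at-b) =
  Interchangeable-≈ a b (≈-swap c {l} {r}) (Interchangeable-node c r l (λ a∈l → disj a∈l (LeafAt⇒∈ at-a))
    (λ b∈l → disj b∈l (LeafAt⇒∈ at-b)) (siblings⇒Interchangeable r q da db a≢b dr at-a at-b))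

¬Interchangeable-together : ∀ a b c (l r : Tree n) → a ≢ b → Distinct (node c l r) →
  a ∈T l → b ∈T l → ¬ Interchangeable l a b → ¬ Interchangeable (node c l r) a b
¬Interchangeable-together a b c l r a≢b (node dl dr disj) a∈l b∈l ¬int int
  with del-just a l dl (∈⇒≢leaf b∈l (≢-sym a≢b)) | del-just b l dl (∈⇒≢leaf a∈l a≢b)
... | X , eX | Y , eY = mismatch (subst₂ _≈S_ del-a del-b int)
  where
  σ = relabel a b
  del-a : del a (node c l r) ≡ just (node c X r)
  del-a = cong₂ (combine c) eX (del-∉ a r (disj a∈l))
  del-b : renameS σ (del b (node c l r)) ≡ just (node c (rename σ Y) r)
  del-b = begin
    renameS σ (combine c (del b l) (del b r))
      ≡⟨ cong₂ (λ s t → renameS σ (combine c s t)) eY (del-∉ b r (disj b∈l)) ⟩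
    just (node c (rename σ Y) (rename σ r))
      ≡⟨ cong (λ t → just (node c (rename σ Y) t)) (rename-relabel-∉ a b r (disj a∈l)) ⟩
    just (node c (rename σ Y) r)
      ∎
    where open ≡-Reasoning
  mismatch : ¬ just (node c X r) ≈S just (node c (rename σ Y) r)
  mismatch (just (node _ X≈ _)) = ¬int (subst₂ _≈S_ (sym eX) (sym (cong (renameS σ) eY)) (just X≈))
  mismatch (just (swap _ X≈r _)) = disj b∈l (∈-≈ X≈r (∈-del-just⁺ a l eX b∈l (≢-sym a≢b)))

¬Interchangeable-apart : ∀ a b c (l r : Tree n) → a ≢ b → Distinct (node c l r) →
  a ∈T l → l ≢ leaf a → b ∈T r → r ≢ leaf b → ¬ Interchangeable (node c l r) a b
¬Interchangeable-apart a b c l r a≢b (node dl dr disj) a∈l l≢a b∈r r≢b int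
  with del-just a l dl l≢a | del-just b r dr r≢b
... | X , eX | Y , eY = mismatch (subst₂ _≈S_ del-a del-b int)
  where
  σ = relabel a b
  a∉r : ¬ a ∈T r
  a∉r = disj a∈l
  del-a : del a (node c l r) ≡ just (node c X r)
  del-a = cong₂ (combine c) eX (del-∉ a r a∉r)
  del-b : renameS σ (del b (node c l r)) ≡ just (node c (rename σ l) (rename σ Y))
  del-b = cong₂ (λ s t → renameS σ (combine c s t)) (del-∉ b l (λ b∈l → disj b∈l b∈r)) eY
  mismatch : ¬ just (node c X r) ≈S just (node c (rename σ l) (rename σ Y))
  mismatch (just (node _ X≈ _)) = disj (proj₁ (∈-del-just⁻ a l eX (∈-≈ (≈-sym X≈) b∈σl))) b∈r
    where
    b∈σl : b ∈T rename σ l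
    b∈σl = subst (_∈T rename σ l) (relabel-self a b) (∈-rename⁺ σ l a∈l)
  mismatch (just (swap _ X≈ _)) with nonempty X
  ... | x , x∈X with ∈-del-just⁻ a l eX x∈X | ∈-rename⁻ σ Y (∈-≈ X≈ x∈X)
  ... | x∈l , _ | y , y∈Y , x≡σy with ∈-del-just⁻ b r eY y∈Y
  ... | y∈r , _ = disj x∈l (subst (_∈T r) (sym (trans x≡σy (relabel-≢ y≢a))) y∈r)
    where
    y≢a : y ≢ a
    y≢a refl = a∉r y∈r

leaf-child-≉ : ∀ {c d} (s : Str n) {X Y : Tree n} → X ≢ leaf b → Y ≢ leaf b →
               ¬ combine c (just (leaf b)) s ≈S just (node d X Y)
leaf-child-≉ nothing  _   _   (just ())
leaf-child-≉ (just _) X≢b _   (just (node _ b≈X _)) = X≢b (≈-leaf⁻ (≈-sym b≈X))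
leaf-child-≉ (just _) _   Y≢b (just (swap _ b≈Y _)) = Y≢b (≈-leaf⁻ (≈-sym b≈Y))

¬Interchangeable-leaf-beside-deep : ∀ a b c d (X Y : Tree n) → a ≢ b →
  Distinct (node c (leaf a) (node d X Y)) → X ≢ leaf b → Y ≢ leaf b →
  ¬ Interchangeable (node c (leaf a) (node d X Y)) a b
¬Interchangeable-leaf-beside-deep a b c d X Y a≢b (node _ dr disj) X≢b Y≢b int
  with del-just b (node d X Y) dr (λ ())
... | R , eR = leaf-child-≉ (just (rename σ R)) X≢b Y≢b (≈S-sym (subst₂ _≈S_ del-a del-b int))
  where
  σ = relabel a b
  del-a : del a (node c (leaf a) (node d X Y)) ≡ just (node d X Y)
  del-a = cong₂ (combine c) (del-leaf-self a) (del-∉ a (node d X Y) (disj (here refl)))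
  del-b : renameS σ (del b (node c (leaf a) (node d X Y))) ≡ just (node c (leaf b) (rename σ R))
  del-b = begin
    renameS σ (combine c (del b (leaf a)) (del b (node d X Y)))
      ≡⟨ cong₂ (λ s t → renameS σ (combine c s t)) (del-leaf a≢b) eR ⟩
    just (node c (leaf (σ a)) (rename σ R))
      ≡⟨ cong (λ z → just (node c (leaf z) (rename σ R))) (relabel-self a b) ⟩
    just (node c (leaf b) (rename σ R))
      ∎
    where open ≡-Reasoning

¬Interchangeable-induction : NonSiblingInduction {n} (λ t a b → ¬ Interchangeable t a b)
¬Interchangeable-induction = record
  { mirror = λ a b c l r ¬int int → ¬int (Interchangeable-≈ a b (≈-swap c {r} {l}) int)
  ; flip = λ a b t ¬int int → ¬int (Interchangeable-sym a b t int)
  ; leaf-beside-deep = ¬Interchangeable-leaf-beside-deep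
  ; apart = ¬Interchangeable-apart
  ; together = λ a b c l r a≢b dt a∈l b∈l _ → ¬Interchangeable-together a b c l r a≢b dt a∈l b∈l
  }

data RestrictedToNode (U : ℕ → Bool) (w : Tree n) (c : Fin n) (X Y : Tree n) : Set where
  vanishes : ∀ {c′ w₁ w₂} → w ≈ node c′ w₁ w₂ →
             restrict U w₁ ≡ nothing → restrict U w₂ ≈S just (node c X Y) → RestrictedToNode U w c X Y
  splits : ∀ {w₁ w₂} → w ≈ node c w₁ w₂ →
           restrict U w₁ ≈S just X → restrict U w₂ ≈S just Y → RestrictedToNode U w c X Y

restricted-to-node : ∀ U (w : Tree n) {c X Y} → restrict U w ≈S just (node c X Y) → RestrictedToNode U w c X Y
restricted-to-node U (leaf x) h with U x
restricted-to-node U (leaf x) (just ()) | true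
restricted-to-node U (leaf x) ()        | false
restricted-to-node U (node c w₁ w₂) h with restrict U w₁ in e₁ | restrict U w₂ in e₂
... | nothing | _       = vanishes ≈-refl e₁ (≈S-trans (≡⇒≈S e₂) h)
... | just _  | nothing = vanishes (≈-swap c) e₂ (≈S-trans (≡⇒≈S e₁) h)
... | just _  | just _  with h
... | just (node _ p q) = splits ≈-refl (subst₂ _≈S_ (sym e₁) refl (just p)) (subst₂ _≈S_ (sym e₂) refl (just q))
... | just (swap _ p q) = splits (≈-swap c) (subst₂ _≈S_ (sym e₂) refl (just q)) (subst₂ _≈S_ (sym e₁) refl (just p))

Reconstructible : Tree n → ℕ → ℕ → Set
Reconstructible t a b = ∀ w → Distinct w → del a w ≈S del a t → del b w ≈S del b t → w ≈ t

deleted-leaf-child-≉ : ∀ {c c′ P Q} (w₁ w₂ : Tree n) → a ≢ b → Distinct w₁ → del a w₁ ≡ nothing →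
                       P ≢ leaf a → Q ≢ leaf a → ¬ del b (node c′ w₁ w₂) ≈S just (node c P Q)
deleted-leaf-child-≉ {a = a} {c′ = c′} w₁ w₂ a≢b dw₁ e P≢a Q≢a h
  with del≡nothing a w₁ dw₁ e
... | refl = leaf-child-≉ (del _ w₂) P≢a Q≢a (subst (λ s → combine c′ s (del _ w₂) ≈S _) (del-leaf a≢b) h)

∈-del-≈just : ∀ a (w : Tree n) {X} → del a w ≈S just X → x ∈T X → x ∈T w
∈-del-≈just a w h x∈X = proj₁ (∈-del⁻ a w (∈-just-≈S h x∈X))

Reconstructible-together : ∀ a b c (l r : Tree n) → a ≢ b → Distinct (node c l r) → a ∈T l → b ∈T l →
                           Third l a b → Reconstructible l a b → Reconstructible (node c l r) a b
Reconstructible-together a b c l r a≢b (node dl dr disj) a∈l b∈l (z , z∈l , z≢a , z≢b) rec w dw hA hB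
  with del-just a l dl (∈⇒≢leaf z∈l z≢a) | del-just b l dl (∈⇒≢leaf z∈l z≢b)
... | A , eA | B , eB = from-view (restricted-to-node (_≢ᵇ a) w hA′)
  where
  hA′ : del a w ≈S just (node c A r)
  hA′ = ≈S-trans hA (≡⇒≈S (cong₂ (combine c) eA (del-∉ a r (disj a∈l))))
  hB′ : del b w ≈S just (node c B r)
  hB′ = ≈S-trans hB (≡⇒≈S (cong₂ (combine c) eB (del-∉ b r (disj b∈l))))
  from-view : RestrictedToNode (_≢ᵇ a) w c A r → w ≈ node c l r
  from-view (vanishes {w₁ = w₁} {w₂} w≈ e₁ _) with Distinct-≈ w≈ dw
  ... | node dw₁ _ _ =
    ⊥-elim (deleted-leaf-child-≉ w₁ w₂ a≢b dw₁ e₁ B≢a r≢a (≈S-trans (del-≈ b (≈-sym w≈)) hB′))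
    where
    B≢a : B ≢ leaf a
    B≢a = ∈⇒≢leaf (∈-del-just⁺ b l eB z∈l z≢b) z≢a
    r≢a : r ≢ leaf a
    r≢a refl = disj a∈l (here refl)
  from-view (splits {w₁} {w₂} w≈ p₁ p₂) with Distinct-≈ w≈ dw
  ... | node dw₁ dw₂ disjw
    with del-just b w₁ dw₁ (∈⇒≢leaf (∈-del-≈just a w₁ p₁ (∈-del-just⁺ a l eA z∈l z≢a)) z≢b)
  ... | K , eK = ≈-trans w≈ (rebuild (subst₂ _≈S_ del-b-w refl (≈S-trans (del-≈ b (≈-sym w≈)) hB′)))
    where
    b∈w₁ : b ∈T w₁
    b∈w₁ = ∈-del-≈just a w₁ p₁ (∈-del-just⁺ a l eA b∈l (≢-sym a≢b))
    del-b-w : del b (node c w₁ w₂) ≡ just (node c K w₂)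
    del-b-w = cong₂ (combine c) eK (del-∉ b w₂ (disjw b∈w₁))
    rebuild : just (node c K w₂) ≈S just (node c B r) → node c w₁ w₂ ≈ node c l r
    rebuild (just (node _ K≈B w₂≈r)) =
      node c (rec w₁ dw₁ (subst₂ _≈S_ refl (sym eA) p₁) (subst₂ _≈S_ (sym eK) (sym eB) (just K≈B))) w₂≈r
    rebuild (just (swap _ K≈r w₂≈B)) with nonempty r
    ... | x , x∈r =
      ⊥-elim (disj (proj₁ (∈-del-just⁻ b l eB (∈-≈ w₂≈B (∈-del-≈just a w₂ p₂ x∈r)))) x∈r)

Reconstructible-apart : ∀ a b c (l r : Tree n) → a ≢ b → Distinct (node c l r) →
                        a ∈T l → l ≢ leaf a → b ∈T r → r ≢ leaf b → Reconstructible (node c l r) a b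
Reconstructible-apart a b c l r a≢b (node dl dr disj) a∈l l≢a b∈r r≢b w dw hA hB
  with del-just a l dl l≢a | del-just b r dr r≢b
... | A , eA | B , eB = from-view (restricted-to-node (_≢ᵇ a) w hA′)
  where
  hA′ : del a w ≈S just (node c A r)
  hA′ = ≈S-trans hA (≡⇒≈S (cong₂ (combine c) eA (del-∉ a r (disj a∈l))))
  hB′ : del b w ≈S just (node c l B)
  hB′ = ≈S-trans hB (≡⇒≈S (cong₂ (combine c) (del-∉ b l (λ b∈l → disj b∈l b∈r)) eB))
  from-view : RestrictedToNode (_≢ᵇ a) w c A r → w ≈ node c l r
  from-view (vanishes {w₁ = w₁} {w₂} w≈ e₁ _) with Distinct-≈ w≈ dw
  ... | node dw₁ _ _ =
    ⊥-elim (deleted-leaf-child-≉ w₁ w₂ a≢b dw₁ e₁ l≢a B≢a (≈S-trans (del-≈ b (≈-sym w≈)) hB′))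
    where
    B≢a : B ≢ leaf a
    B≢a refl = disj a∈l (proj₁ (∈-del-just⁻ b r eB (here refl)))
  from-view (splits {w₁} {w₂} w≈ p₁ p₂) with Distinct-≈ w≈ dw
  ... | node dw₁ dw₂ disjw with del-just b w₂ dw₂ w₂≢b
    where
    w₂≢b : w₂ ≢ leaf b
    w₂≢b refl = r≢b (≈-leaf⁻ (≈-sym (just-≈⁻ (subst₂ _≈S_ (del-leaf (≢-sym a≢b)) refl p₂))))
  ... | K , eK = ≈-trans w≈ (rebuild (subst₂ _≈S_ del-b-w refl (≈S-trans (del-≈ b (≈-sym w≈)) hB′)))
    where
    b∉w₁ : ¬ b ∈T w₁
    b∉w₁ b∈w₁ = disjw b∈w₁ (∈-del-≈just a w₂ p₂ b∈r)
    del-b-w : del b (node c w₁ w₂) ≡ just (node c w₁ K)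
    del-b-w = cong₂ (combine c) (del-∉ b w₁ b∉w₁) eK
    rebuild : just (node c w₁ K) ≈S just (node c l B) → node c w₁ w₂ ≈ node c l r
    rebuild (just (node _ w₁≈l _)) = node c w₁≈l (just-≈⁻ (subst₂ _≈S_ (del-∉ a w₂ a∉w₂) refl p₂))
      where
      a∉w₂ : ¬ a ∈T w₂
      a∉w₂ = disjw (∈-≈ (≈-sym w₁≈l) a∈l)
    rebuild (just (swap _ w₁≈B _)) with nonempty A
    ... | x , x∈A = ⊥-elim (disj (proj₁ (∈-del-just⁻ a l eA x∈A))
                                 (proj₁ (∈-del-just⁻ b r eB (∈-≈ w₁≈B (∈-del-≈just a w₁ p₁ x∈A)))))

Reconstructible-leaf-beside-deep : ∀ a b c d (X Y : Tree n) → a ≢ b →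
  Distinct (node c (leaf a) (node d X Y)) → X ≢ leaf b → Y ≢ leaf b →
  Reconstructible (node c (leaf a) (node d X Y)) a b
Reconstructible-leaf-beside-deep a b c d X Y a≢b (node _ dr disj) X≢b Y≢b w dw hA hB
  with del-just b (node d X Y) dr (λ ())
... | R , eR = from-view (restricted-to-node (_≢ᵇ b) w hB′)
  where
  r = node d X Y
  b≢a = ≢-sym a≢b
  hA′ : del a w ≈S just r
  hA′ = ≈S-trans hA (≡⇒≈S (cong₂ (combine c) (del-leaf-self a) (del-∉ a r (disj (here refl)))))
  hB′ : del b w ≈S just (node c (leaf a) R)
  hB′ = ≈S-trans hB (≡⇒≈S (cong₂ (combine c) (del-leaf a≢b) eR))
  from-view : RestrictedToNode (_≢ᵇ b) w c (leaf a) R → w ≈ node c (leaf a) r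
  from-view (vanishes {w₁ = w₁} {w₂} w≈ e₁ _) with Distinct-≈ w≈ dw
  ... | node dw₁ _ _ =
    ⊥-elim (deleted-leaf-child-≉ w₁ w₂ b≢a dw₁ e₁ X≢b Y≢b (≈S-trans (del-≈ a (≈-sym w≈)) hA′))
  from-view (splits {w₁} {w₂} w≈ p₁ p₂) with Distinct-≈ w≈ dw | b ∈? leaves w₁
  ... | node _ _ disjw | no b∉w₁ with ≈-leaf⁻ (just-≈⁻ (subst₂ _≈S_ (del-∉ b w₁ b∉w₁) refl p₁))
  ... | refl = ≈-trans w≈ (node c (leaf a) (just-≈⁻ (subst₂ _≈S_ del-a-w₂ refl hA-w)))
    where
    del-a-w₂ : del a (node c (leaf a) w₂) ≡ just w₂
    del-a-w₂ = cong₂ (combine c) (del-leaf-self a) (del-∉ a w₂ (disjw (here refl)))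
    hA-w : del a (node c (leaf a) w₂) ≈S just r
    hA-w = ≈S-trans (del-≈ a (≈-sym w≈)) hA′
  from-view (splits {w₁} {w₂} w≈ p₁ p₂) | node dw₁ _ _ | yes b∈w₁
    with del-just a w₁ dw₁ (∈⇒≢leaf b∈w₁ b≢a)
  ... | K , eK with Distinct⇒≡leaf K (Distinct-del a w₁ dw₁ eK) only-b
    where
    only-b : ∀ {x} → x ∈T K → x ≡ b
    only-b {x} x∈K with x ≟ b | ∈-del-just⁻ a w₁ eK x∈K
    ... | yes x≡b | _ = x≡b
    ... | no x≢b  | x∈w₁ , x≢a = ⊥-elim (x≢a (singleton⁻ (∈-≈S-just p₁ (∈-del⁺ b w₁ x∈w₁ x≢b))))
  ... | refl = ⊥-elim (leaf-child-≉ (del a w₂) X≢b Y≢b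
                 (subst₂ _≈S_ (cong (λ s → combine c s (del a w₂)) eK) refl
                   (≈S-trans (del-≈ a (≈-sym w≈)) hA′)))

Reconstructible-induction : NonSiblingInduction {n} Reconstructible
Reconstructible-induction = record
  { mirror = λ a b c l r rec w dw hA hB →
      ≈-trans (rec w dw (≈S-trans hA (del-≈ a (≈-swap c {l} {r}))) (≈S-trans hB (del-≈ b (≈-swap c {l} {r}))))
              (≈-swap c)
  ; flip = λ a b t rec w dw hA hB → rec w dw hB hA
  ; leaf-beside-deep = Reconstructible-leaf-beside-deep
  ; apart = Reconstructible-apart
  ; together = Reconstructible-together
  }

∈-image : ∀ f (xs : List ℕ) {w} → (∃ λ x → x ∈ xs × f x ≡ w) → ⌊ w ∈? map f xs ⌋ ≡ true
∈-image f xs (x , x∈ , refl) = ⌊⌋-true (f x ∈? map f xs) (∈-map⁺ f x∈)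

Embedding-inclusion : ∀ a (t z : Tree n) → (∀ {w} → w ∈T z → w ∈T t) → del a z ≈S del a t →
                      Embedding id (del a t) (just z)
Embedding-inclusion a t z z⊆t del≈ = (λ _ _ e → e) , (begin
  restrict (λ w → ⌊ w ∈? map id (leavesS (del a t)) ⌋) z  ≡⟨ restrict-cong _ (_≢ᵇ a) z kept ⟩
  del a z                                                 ≈⟨ del≈ ⟩
  del a t                                                 ≡⟨ renameS-id (del a t) ⟨
  renameS id (del a t)                                    ∎)
  where
  open ≈S-Reasoning
  kept : w ∈T z → ⌊ w ∈? map id (leavesS (del a t)) ⌋ ≡ (w ≢ᵇ a)
  kept {w} w∈ rewrite map-id (leavesS (del a t)) =
    ⌊⌋-reflects (w ∈? leavesS (del a t)) (≢⇒≢ᵇ ∘ proj₂ ∘ ∈-del⁻ a t)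
                (∈-del⁺ a t (z⊆t w∈) ∘ ≢ᵇ⇒≢)

amalgamation-by-inclusion : ∀ (t z : Tree n) → a ≢ b → (∀ {w} → w ∈T z → w ∈T t) →
  del a z ≈S del a t → del b z ≈S del b t → IsAmalgamation (del a t) (del b t) (del2 a b t) (just z) id id
amalgamation-by-inclusion {a = a} {b} t z a≢b z⊆t del-a del-b =
  Embedding-inclusion a t z z⊆t del-a , Embedding-inclusion b t z z⊆t del-b , (λ _ → refl) , cover
  where
  cover : w ∈T z → (∃ λ x → x ∈ leavesS (del a t) × id x ≡ w) ⊎
                   (∃ λ y → y ∈ leavesS (del b t) × id y ≡ w)
  cover {w} w∈ with w ≟ a
  ... | yes refl = inj₂ (w , ∈-del⁺ b t (z⊆t w∈) a≢b , refl)
  ... | no w≢a   = inj₁ (w , ∈-del⁺ a t (z⊆t w∈) w≢a , refl)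

Embedding-refl : (s : Str n) → Embedding id s s
Embedding-refl s = (λ _ _ e → e) , ≡⇒≈S (trans (restrictS-all _ s kept) (sym (renameS-id s)))
  where
  kept : w ∈ leavesS s → ⌊ w ∈? map id (leavesS s) ⌋ ≡ true
  kept {w} w∈ = ⌊⌋-true (w ∈? map id (leavesS s)) (subst (w ∈_) (sym (map-id (leavesS s))) w∈)

Interchangeable⇒¬Separated : ∀ (t : Tree n) → a ≢ b → a ∈T t → b ∈T t → Distinct t →
                             Interchangeable t a b → ¬ Separated t a b
Interchangeable⇒¬Separated {a = a} {b} t a≢b a∈t b∈t dt int (_ , unique)
  with unique (del a t) id σ (Distinctˢ⇒Unique (del a t) (Distinct-restrict _ t dt)) competitor
  where
  σ = relabel a b
  LA = leavesS (del a t)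
  LB = leavesS (del b t)
  σ-injective : InjOn σ LB
  σ-injective {x} {y} x∈ y∈ σx≡σy with x ≟ a | y ≟ a
  ... | yes x≡a | yes y≡a = trans x≡a (sym y≡a)
  ... | yes _   | no _    = ⊥-elim (proj₂ (∈-del⁻ b t y∈) (sym σx≡σy))
  ... | no _    | yes _   = ⊥-elim (proj₂ (∈-del⁻ b t x∈) σx≡σy)
  ... | no _    | no _    = σx≡σy
  in-image-σ : w ∈ LA → ⌊ w ∈? map σ LB ⌋ ≡ true
  in-image-σ {w} w∈ with ∈-del⁻ a t w∈ | w ≟ b
  ... | _ , _ | yes refl = ∈-image σ LB (a , ∈-del⁺ b t a∈t a≢b , relabel-self a b)
  ... | w∈t , w≢a | no w≢b = ∈-image σ LB (w , ∈-del⁺ b t w∈t w≢b , relabel-≢ w≢a)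
  competitor : IsAmalgamation (del a t) (del b t) (del2 a b t) (del a t) id σ
  competitor =
    Embedding-refl (del a t) ,
    (σ-injective , ≈S-trans (≡⇒≈S (restrictS-all _ (del a t) in-image-σ)) int) ,
    (λ x∈ → sym (relabel-≢ (∈-del2⁻ a b t x∈))) ,
    (λ {w} w∈ → inj₁ (w , w∈ , refl))
... | h , (_ , rename≈) , _ =
  <-irrefl (length-renameS-≈ h (del a t) rename≈) (length-restrict-< _ t a∈t (≢ᵇ-refl a))

record Rival (t : Tree n) (x y : ℕ) : Set where
  field
    tree : Tree n
    distinct : Distinct tree
    ⊆t : ∀ {w} → w ∈T tree → w ∈T t
    ⊇t : ∀ {w} → w ∈T t → w ∈T tree
    del-x : del x tree ≈S del x t
    del-y : del y tree ≈S del y t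
    ≉t : ¬ tree ≈ t

Rival-≈ : {s t : Tree n} → s ≈ t → Rival t x y → Rival s x y
Rival-≈ {x = x} {y} s≈t ρ = record
  { tree = tree ; distinct = distinct
  ; ⊆t = λ w∈ → ∈-≈ (≈-sym s≈t) (⊆t w∈) ; ⊇t = λ w∈ → ⊇t (∈-≈ s≈t w∈)
  ; del-x = ≈S-trans del-x (del-≈ x (≈-sym s≈t)) ; del-y = ≈S-trans del-y (del-≈ y (≈-sym s≈t))
  ; ≉t = λ ≈s → ≉t (≈-trans ≈s s≈t)
  }
  where open Rival ρ

rotation : ∀ c e (S : Tree n) → x ≢ y → Distinct (node c (leaf x) (node e (leaf y) S)) →
           Rival (node c (leaf x) (node e (leaf y) S)) x y
rotation {n = n} {x = x} {y = y} c e S x≢y (node _ (node _ dS y∉S) x∉yS) = record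
  { tree = node e (leaf y) (node c (leaf x) S)
  ; distinct = node leaf (node leaf dS (λ { (here refl) w∈S → x∉yS (here refl) (there w∈S) }))
                     λ { (here refl) (here x≡y) → x≢y (sym x≡y)
                       ; (here refl) (there w∈S) → y∉S (here refl) w∈S }
  ; ⊆t = exchange ; ⊇t = exchange
  ; del-x = ≡⇒≈S del-x ; del-y = ≡⇒≈S del-y
  ; ≉t = λ { (node _ y≈x _) → x≢y (sym (leaf-≈⁻ y≈x)) ; (swap _ () _) }
  }
  where
  exchange : ∀ {w u v} {ws : List ℕ} → w ∈ u ∷ v ∷ ws → w ∈ v ∷ u ∷ ws
  exchange (here w≡u)         = there (here w≡u)
  exchange (there (here w≡v)) = here w≡v
  exchange (there (there w∈)) = there (there w∈)
  del-x : del x (node e (leaf y) (node c (leaf x) S)) ≡ del x (node c (leaf x) (node e (leaf y) S))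
  del-x rewrite del-leaf-self {n = n} x | del-leaf {n = n} (≢-sym x≢y)
              | del-∉ x S (λ x∈S → x∉yS (here refl) (there x∈S)) = refl
  del-y : del y (node e (leaf y) (node c (leaf x) S)) ≡ del y (node c (leaf x) (node e (leaf y) S))
  del-y rewrite del-leaf-self {n = n} y | del-leaf {n = n} x≢y | del-∉ y S (y∉S (here refl)) = refl

Rival-node : ∀ c (l r : Tree n) → Distinct (node c l r) → x ∈T l → Rival l x y → Rival (node c l r) x y
Rival-node {x = x} {y} c l r (node _ dr disj) x∈l ρ = record
  { tree = node c tree r
  ; distinct = node distinct dr λ w∈ w∈r → disj (⊆t w∈) w∈r
  ; ⊆t = λ w∈ → [ (λ w∈Z → ∈-++⁺ˡ (⊆t w∈Z)) , ∈-++⁺ʳ (leaves l) ]′ (∈-++⁻ (leaves tree) w∈)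
  ; ⊇t = λ w∈ → [ (λ w∈l → ∈-++⁺ˡ (⊇t w∈l)) , ∈-++⁺ʳ (leaves tree) ]′ (∈-++⁻ (leaves l) w∈)
  ; del-x = combine-≈ c del-x ≈S-refl ; del-y = combine-≈ c del-y ≈S-refl
  ; ≉t = λ { (node _ Z≈l _) → ≉t Z≈l ; (swap _ Z≈r _) → disj x∈l (∈-≈ Z≈r (⊇t x∈l)) }
  }
  where open Rival ρ

rival-at-root : ∀ (t : Tree n) dx d dy → x ≢ y → Distinct t →
                LeafAt t [ dx ] x → LeafAt t (d ∷ dy ∷ []) y → Rival t x y
rival-at-root (node c _ (node e _ S)) false true false x≢y dt (goL here) (goR (goL here)) = rotation c e S x≢y dt
rival-at-root (node c _ (node e S _)) false true true x≢y dt (goL here) (goR (goR here)) =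
  Rival-≈ flip-e (rotation c e S x≢y (Distinct-≈ flip-e dt))
  where
  flip-e = node c ≈-refl (≈-swap e)
rival-at-root (node c (node e _ S) _) true false false x≢y dt (goR here) (goL (goL here)) =
  Rival-≈ flip-c (rotation c e S x≢y (Distinct-≈ flip-c dt))
  where
  flip-c = ≈-swap c
rival-at-root (node c (node e S _) _) true false true x≢y dt (goR here) (goL (goR here)) =
  Rival-≈ flip-ce (rotation c e S x≢y (Distinct-≈ flip-ce dt))
  where
  flip-ce = swap c (≈-swap e) ≈-refl
rival-at-root _ false false _ _ _ (goL here) (goL ())
rival-at-root _ true true _ _ _ (goR here) (goR ())

adjacent⇒Rival : ∀ (t : Tree n) p dx d dy → x ≢ y → Distinct t →
                 LeafAt t (p ++ [ dx ]) x → LeafAt t ((p ++ [ d ]) ++ [ dy ]) y → Rival t x y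
adjacent⇒Rival t [] dx d dy x≢y dt at-x at-y = rival-at-root t dx d dy x≢y dt at-x at-y
adjacent⇒Rival (node c l r) (false ∷ p) dx d dy x≢y dt@(node dl _ _) (goL at-x) (goL at-y) =
  Rival-node c l r dt (LeafAt⇒∈ at-x) (adjacent⇒Rival l p dx d dy x≢y dl at-x at-y)
adjacent⇒Rival (node c l r) (true ∷ p) dx d dy x≢y dt@(node _ dr _) (goR at-x) (goR at-y) =
  Rival-≈ (≈-swap c)
    (Rival-node c r l (Distinct-swap dt) (LeafAt⇒∈ at-x) (adjacent⇒Rival r p dx d dy x≢y dr at-x at-y))

Rival-sym : {t : Tree n} → Rival t x y → Rival t y x
Rival-sym ρ = record { Rival ρ ; del-x = Rival.del-y ρ ; del-y = Rival.del-x ρ }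

module _ {t : Tree n} (a≢b : a ≢ b) (ρ : Rival t a b) where
  open Rival ρ

  Rival⇒¬Separated : ¬ Separated t a b
  Rival⇒¬Separated (_ , unique)
    with unique (just tree) id id (Distinct⇒Unique tree distinct)
                (amalgamation-by-inclusion t tree a≢b ⊆t del-x del-y)
  ... | h , (_ , just rename≈) , h-a , h-b =
    ≉t (subst (_≈ t) (trans (rename-cong h id tree h≗id) (rename-id tree)) rename≈)
    where
    h≗id : w ∈T tree → h w ≡ w
    h≗id {w} w∈ with w ≟ a
    ... | yes refl = h-b (∈-del⁺ b t (⊆t w∈) a≢b)
    ... | no w≢a   = h-a (∈-del⁺ a t (⊆t w∈) w≢a)

preimage : (ℕ → ℕ) → List ℕ → ℕ → Maybe ℕ
preimage f []       w = nothing
preimage f (x ∷ xs) w = if ⌊ f x ≟ w ⌋ then just x else preimage f xs w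

preimage-sound : ∀ f xs {w x} → preimage f xs w ≡ just x → x ∈ xs × f x ≡ w
preimage-sound f (y ∷ xs) {w} e with f y ≟ w
preimage-sound f (y ∷ xs) refl | yes fy≡w = here refl , fy≡w
... | no _ = let x∈ , fx≡w = preimage-sound f xs e in there x∈ , fx≡w

preimage-injective : ∀ f xs {x} → InjOn f xs → x ∈ xs → preimage f xs (f x) ≡ just x
preimage-injective f xs {x} inj x∈ with preimage f xs (f x) in e
... | just x′ = let x′∈ , fx′≡fx = preimage-sound f xs e in cong just (inj x′∈ x∈ fx′≡fx)
... | nothing = ⊥-elim (absent xs x∈ e)
  where
  absent : ∀ ys → x ∈ ys → preimage f ys (f x) ≢ nothing
  absent (y ∷ ys) y∈ e′ with f y ≟ f x
  absent (y ∷ ys) (here refl) e′ | no fy≢fx = fy≢fx refl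
  absent (y ∷ ys) (there x∈ys) e′ | no _ = absent ys x∈ys e′

restrict-rename-embedding : ∀ f h k U (S : Str n) (z : Tree n) → Embedding f S (just z) →
  (∀ {x} → x ∈ leavesS S → h (f x) ≡ k x) →
  (∀ {w} → w ∈T z → U (h w) ≡ ⌊ w ∈? map f (leavesS S) ⌋) →
  restrict U (rename h z) ≈S renameS k S
restrict-rename-embedding f h k U S z (_ , image≈) h∘f≗k U∘h≗image = begin
  restrict U (rename h z)
    ≡⟨ renameS-restrict h U z ⟨
  renameS h (restrict (λ w → U (h w)) z)
    ≡⟨ cong (renameS h) (restrict-cong _ _ z U∘h≗image) ⟩
  renameS h (restrict (λ w → ⌊ w ∈? map f (leavesS S) ⌋) z)
    ≈⟨ renameS-≈ h image≈ ⟩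
  renameS h (renameS f S)
    ≡⟨ renameS-∘ h f S ⟩
  renameS (λ x → h (f x)) S
    ≡⟨ renameS-cong _ k S h∘f≗k ⟩
  renameS k S
    ∎
  where open ≈S-Reasoning

module Uniqueness {T : Tree n} {a b : ℕ} (a≢b : a ≢ b) (a∈T : a ∈T T) (b∈T : b ∈T T)
  (¬int : ¬ Interchangeable T a b) (rec : Reconstructible T a b)
  {z : Tree n} {f g : ℕ → ℕ} (uz : Unique (leaves z))
  (am : IsAmalgamation (del a T) (del b T) (del2 a b T) (just z) f g) where

  private
    LA = leavesS (del a T)
    LB = leavesS (del b T)
    embA = proj₁ am
    embB = proj₁ (proj₂ am)
    injA = proj₁ embA
    injB = proj₁ embB
    cover = proj₂ (proj₂ (proj₂ am))
    agree : x ∈T T → x ≢ a → x ≢ b → f x ≡ g x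
    agree x∈ x≢a x≢b = proj₁ (proj₂ (proj₂ am)) (∈-del2⁺ a b T x∈ x≢a x≢b)

    b∈LA : b ∈ LA
    b∈LA = ∈-del⁺ a T b∈T (≢-sym a≢b)

    a∈LB : a ∈ LB
    a∈LB = ∈-del⁺ b T a∈T a≢b

  h : ℕ → ℕ
  h w = fromMaybe w (preimage f LA w <∣> preimage g LB w)

  h∘f : x ∈ LA → h (f x) ≡ x
  h∘f x∈ rewrite preimage-injective f LA injA x∈ = refl

  fb≢ga : f b ≢ g a
  fb≢ga fb≡ga = ¬int (subst₂ _≈S_ (renameS-id (del a T)) refl (≈S-trans (≈S-sym via-f) via-g))
    where
    σ = relabel a b
    in-image-f : w ∈T z → ∃ λ x → x ∈ LA × f x ≡ w
    in-image-f w∈ with cover w∈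
    ... | inj₁ from-f = from-f
    ... | inj₂ (y , y∈ , refl) with y ≟ a | ∈-del⁻ b T y∈
    ...   | yes refl | _ = b , b∈LA , fb≡ga
    ...   | no y≢a | y∈T , y≢b = y , ∈-del⁺ a T y∈T y≢a , agree y∈T y≢a y≢b
    in-image-g : w ∈T z → ∃ λ y → y ∈ LB × g y ≡ w
    in-image-g w∈ with cover w∈
    ... | inj₂ from-g = from-g
    ... | inj₁ (x , x∈ , refl) with x ≟ b | ∈-del⁻ a T x∈
    ...   | yes refl | _ = a , a∈LB , sym fb≡ga
    ...   | no x≢b | x∈T , x≢a = x , ∈-del⁺ b T x∈T x≢b , sym (agree x∈T x≢a x≢b)
    h∘g≗σ : y ∈ LB → h (g y) ≡ σ y
    h∘g≗σ {y} y∈ with y ≟ a | ∈-del⁻ b T y∈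
    ... | yes refl | _ = trans (cong h (sym fb≡ga)) (h∘f b∈LA)
    ... | no y≢a | y∈T , y≢b = trans (cong h (sym (agree y∈T y≢a y≢b))) (h∘f (∈-del⁺ a T y∈T y≢a))
    via-f : restrict (λ _ → true) (rename h z) ≈S renameS id (del a T)
    via-f = restrict-rename-embedding f h id _ (del a T) z embA h∘f (sym ∘ ∈-image f LA ∘ in-image-f)
    via-g : restrict (λ _ → true) (rename h z) ≈S renameS σ (del b T)
    via-g = restrict-rename-embedding g h σ _ (del b T) z embB h∘g≗σ (sym ∘ ∈-image g LB ∘ in-image-g)

  h∘g : y ∈ LB → h (g y) ≡ y
  h∘g {y} y∈ with preimage f LA (g y) in e
  ... | just x = from-f (preimage-sound f LA e)
    where
    from-f : x ∈ LA × f x ≡ g y → x ≡ y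
    from-f (x∈ , fx≡gy) with y ≟ a | ∈-del⁻ b T y∈
    ... | no y≢a | y∈T , y≢b = injA x∈ (∈-del⁺ a T y∈T y≢a) (trans fx≡gy (sym (agree y∈T y≢a y≢b)))
    ... | yes refl | _ with x ≟ b | ∈-del⁻ a T x∈
    ...   | yes refl | _ = ⊥-elim (fb≢ga fx≡gy)
    ...   | no x≢b | x∈T , x≢a =
      ⊥-elim (x≢a (injB (∈-del⁺ b T x∈T x≢b) a∈LB (trans (sym (agree x∈T x≢a x≢b)) fx≡gy)))
  ... | nothing rewrite preimage-injective g LB injB y∈ = refl

  private
    shared : x ∈ LA → x ∈ LB → f x ≡ g x
    shared x∈LA x∈LB = let x∈T , x≢a = ∈-del⁻ a T x∈LA in agree x∈T x≢a (proj₂ (∈-del⁻ b T x∈LB))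

  h-injective : InjOn h (leaves z)
  h-injective w₁∈ w₂∈ hw₁≡hw₂ with cover w₁∈ | cover w₂∈
  ... | inj₁ (x₁ , x₁∈ , refl) | inj₁ (x₂ , x₂∈ , refl) =
    cong f (trans (sym (h∘f x₁∈)) (trans hw₁≡hw₂ (h∘f x₂∈)))
  ... | inj₂ (y₁ , y₁∈ , refl) | inj₂ (y₂ , y₂∈ , refl) =
    cong g (trans (sym (h∘g y₁∈)) (trans hw₁≡hw₂ (h∘g y₂∈)))
  ... | inj₁ (x₁ , x₁∈ , refl) | inj₂ (y₂ , y₂∈ , refl)
    with refl ← trans (sym (h∘f x₁∈)) (trans hw₁≡hw₂ (h∘g y₂∈)) = shared x₁∈ y₂∈
  ... | inj₂ (y₁ , y₁∈ , refl) | inj₁ (x₂ , x₂∈ , refl)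
    with refl ← trans (sym (h∘g y₁∈)) (trans hw₁≡hw₂ (h∘f x₂∈)) = sym (shared x₂∈ y₁∈)

  private
    kept-by-f : w ∈T z → (h w ≢ᵇ a) ≡ ⌊ w ∈? map f LA ⌋
    kept-by-f {w} w∈ = sym (⌊⌋-reflects (w ∈? map f LA) from-image to-image)
      where
      from-image : w ∈ map f LA → (h w ≢ᵇ a) ≡ true
      from-image w∈img with ∈-map⁻ f w∈img
      ... | x , x∈ , refl = ≢⇒≢ᵇ (subst (_≢ a) (sym (h∘f x∈)) (proj₂ (∈-del⁻ a T x∈)))
      to-image : (h w ≢ᵇ a) ≡ true → w ∈ map f LA
      to-image hw≢a with cover w∈
      ... | inj₁ (x , x∈ , refl) = ∈-map⁺ f x∈
      ... | inj₂ (y , y∈ , refl) with ∈-del⁻ b T y∈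
      ...   | y∈T , y≢b =
        subst (_∈ map f LA) (agree y∈T y≢a y≢b) (∈-map⁺ f (∈-del⁺ a T y∈T y≢a))
        where
        y≢a : y ≢ a
        y≢a = subst (_≢ a) (h∘g y∈) (≢ᵇ⇒≢ hw≢a)

    kept-by-g : w ∈T z → (h w ≢ᵇ b) ≡ ⌊ w ∈? map g LB ⌋
    kept-by-g {w} w∈ = sym (⌊⌋-reflects (w ∈? map g LB) from-image to-image)
      where
      from-image : w ∈ map g LB → (h w ≢ᵇ b) ≡ true
      from-image w∈img with ∈-map⁻ g w∈img
      ... | y , y∈ , refl = ≢⇒≢ᵇ (subst (_≢ b) (sym (h∘g y∈)) (proj₂ (∈-del⁻ b T y∈)))
      to-image : (h w ≢ᵇ b) ≡ true → w ∈ map g LB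
      to-image hw≢b with cover w∈
      ... | inj₂ (y , y∈ , refl) = ∈-map⁺ g y∈
      ... | inj₁ (x , x∈ , refl) with ∈-del⁻ a T x∈
      ...   | x∈T , x≢a =
        subst (_∈ map g LB) (sym (agree x∈T x≢a x≢b)) (∈-map⁺ g (∈-del⁺ b T x∈T x≢b))
        where
        x≢b : x ≢ b
        x≢b = subst (_≢ b) (h∘f x∈) (≢ᵇ⇒≢ hw≢b)

  amalgamation-equivalent : AmalgEquiv (del a T) (del b T) (just z) f g (just T) id id
  amalgamation-equivalent = h , (h-injective , just (rec (rename h z) distinct del-a del-b)) , h∘f , h∘g
    where
    distinct : Distinct (rename h z)
    distinct = Distinct-rename h z (Unique⇒Distinct z uz) h-injective
    del-a : del a (rename h z) ≈S del a T
    del-a = subst₂ _≈S_ refl (renameS-id _) (restrict-rename-embedding f h id _ (del a T) z embA h∘f kept-by-f)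
    del-b : del b (rename h z) ≈S del b T
    del-b = subst₂ _≈S_ refl (renameS-id _) (restrict-rename-embedding g h id _ (del b T) z embB h∘g kept-by-g)

¬Interchangeable×Reconstructible⇒Separated : ∀ (t : Tree n) → a ≢ b → a ∈T t → b ∈T t →
  ¬ Interchangeable t a b → Reconstructible t a b → Separated t a b
¬Interchangeable×Reconstructible⇒Separated {a = a} {b} t a≢b a∈t b∈t ¬int rec =
  amalgamation-by-inclusion t t a≢b (λ w∈ → w∈) ≈S-refl ≈S-refl , unique
  where
  unique : ∀ Z f g → WellFormed Z → IsAmalgamation (del a t) (del b t) (del2 a b t) Z f g →
           AmalgEquiv (del a t) (del b t) Z f g (just t) id id
  unique (just z) f g uz am = Uniqueness.amalgamation-equivalent a≢b a∈t b∈t ¬int rec uz am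
  unique nothing f g _ ((_ , image≈) , _) = ⊥-elim (empty (del a t) image≈ (∈-del⁺ a t b∈t (≢-sym a≢b)))
    where
    empty : ∀ s → nothing ≈S renameS f s → ¬ b ∈ leavesS s
    empty nothing _ ()

proposition4p1 : ∀ {n : ℕ} (T : Tree n) → Unique (leaves T) →
    (a b : ℕ) → a ≢ b → a ∈ leaves T → b ∈ leaves T →
    (qa qb : List Bool) → ParentAt T a qa → ParentAt T b qb →
    Separated T a b ⇔ (qa ≢ qb × ¬ Adjacent qa qb)
proposition4p1 T uniq a b a≢b a∈T b∈T qa qb (da , at-a) (db , at-b) = mk⇔ necessary sufficient
  where
  dT = Unique⇒Distinct T uniq
  necessary : Separated T a b → qa ≢ qb × ¬ Adjacent qa qb
  necessary sep = siblings , adjacent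
    where
    siblings : qa ≢ qb
    siblings refl =
      Interchangeable⇒¬Separated T a≢b a∈T b∈T dT (siblings⇒Interchangeable T qa da db a≢b dT at-a at-b) sep
    adjacent : ¬ Adjacent qa qb
    adjacent (inj₁ (d , refl)) = Rival⇒¬Separated a≢b (adjacent⇒Rival T qa da d db a≢b dT at-a at-b) sep
    adjacent (inj₂ (d , refl)) =
      Rival⇒¬Separated a≢b (Rival-sym (adjacent⇒Rival T qb db d da (≢-sym a≢b) dT at-b at-a)) sep
  sufficient : qa ≢ qb × ¬ Adjacent qa qb → Separated T a b
  sufficient (qa≢qb , ¬adj) = ¬Interchangeable×Reconstructible⇒Separated T a≢b a∈T b∈T
    (non-sibling-induction ¬Interchangeable-induction T a b a≢b dT qa da qb db at-a at-b qa≢qb ¬adj)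
    (non-sibling-induction Reconstructible-induction T a b a≢b dT qa da qb db at-a at-b qa≢qb ¬adj)
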